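{- Let $\mathcal{H}\subseteq\binom{[n]}{3}$ with $\nu(\mathcal{H})=s$. If $\{i,j\}\in\mathcal{K}_{3s+1}(\mathcal{H})$, then $\nu(\mathcal{H}_{\bar{i},\bar{j}})\leq s-1$.
   Context: $\nu(\mathcal{G})$ is the largest number of pairwise disjoint members of $\mathcal{G}$. For $E\subseteq[n]$, $d_{\mathcal{H}}(E)=|\{F\in\mathcal{H}:E\subseteq F\}|$; $\mathcal{K}_d(\mathcal{H})=\{K\in\binom{[n]}{2}: d_{\mathcal{H}}(K)\geq d\}$. $\mathcal{H}_{\bar{i},\bar{j}}=\{F\in\mathcal{H}: i,j\notin F\}$. -}

module Defs where

open import Data.Nat using (ℕ; _≤_)
open import Data.Fin using (Fin)
open import Data.Fin.Subset using (Subset; _∈_; _∉_; ∣_∣)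
open import Data.Fin.Subset.Properties using (_∈?_)
open import Data.List using (List; filter; length)
open import Data.List.Relation.Unary.All using (All)
open import Data.List.Relation.Unary.AllPairs using (AllPairs)
open import Data.List.Relation.Unary.Unique.Propositional using (Unique)
import Data.List.Relation.Unary.Unique.Propositional.Properties as UniqueP
open import Data.List.Relation.Binary.Sublist.Propositional using (_⊆_)
open import Data.Product using (_×_; Σ; ∃)
open import Data.Empty using (⊥)
open import Relation.Nullary using (¬_)
open import Relation.Nullary.Decidable using (_×-dec_; ¬?)
open import Relation.Binary.PropositionalEquality using (_≡_)

record Family (n : ℕ) : Set where
  constructor family
  field
    members : List (Subset n)
    unique  : Unique members
open Family public

Is3Uniform : ∀ {n} → Family n → Set
Is3Uniform H = All (λ F → ∣ F ∣ ≡ 3) (members H)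

Disjoint : ∀ {n} → Subset n → Subset n → Set
Disjoint p q = ∀ x → x ∈ p → x ∈ q → ⊥

-- A matching in H: a collection of members of H (sublist of the
-- duplicate-free member list, hence distinct members) that are pairwise disjoint.
IsMatching : ∀ {n} → Family n → List (Subset n) → Set
IsMatching H M = (M ⊆ members H) × AllPairs Disjoint M

ν≡ : ∀ {n} → Family n → ℕ → Set
ν≡ H s = Σ (List _) (λ M → IsMatching H M × length M ≡ s)
         × (∀ M → IsMatching H M → length M ≤ s)

ν≤ : ∀ {n} → Family n → ℕ → Set
ν≤ H t = ∀ M → IsMatching H M → length M ≤ t

degree₂ : ∀ {n} → Family n → Fin n → Fin n → ℕ
degree₂ H i j = length (filter (λ F → (i ∈? F) ×-dec (j ∈? F)) (members H))

InK : ∀ {n} → ℕ → Family n → Fin n → Fin n → Set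
InK d H i j = ¬ (i ≡ j) × d ≤ degree₂ H i j

avoid : ∀ {n} → Family n → Fin n → Fin n → Family n
avoid H i j = family (filter (λ F → ¬? (i ∈? F) ×-dec ¬? (j ∈? F)) (members H))
                     (UniqueP.filter⁺ _ (unique H))

-- Let M be a matching of H avoiding i and j.  If some member of H through i and j misses
-- every member of M, adding it to M gives a larger matching of H, so |M| < s.  Otherwise
-- each of the more than 3s members of H through i and j meets the vertex set ⋃ M, which
-- avoids i, j and has at most 3|M| ≤ 3s points.  A 3-set through i and j is determined by
-- its third point, so distinct such members meet ⋃ M in distinct points: a contradiction.
module Submission where

open import Defs
open import Data.Nat using (ℕ; suc; _+_; _*_; _∸_; _≤_; _<_; z≤n; s≤s)
open import Data.Nat.Properties
  using ( ≤-trans; ≤-reflexive; n≤1+n; ≤⇒≯; m+1+n≰m; +-suc; *-suc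
        ; +-mono-≤; +-monoʳ-≤; *-monoʳ-≤; ∸-monoˡ-≤; module ≤-Reasoning)
open import Data.Fin using (Fin)
open import Data.Fin.Properties using (_≟_)
open import Data.Fin.Subset
  using (Subset; inside; outside; _∈_; _∉_; _⊆_; ∣_∣; _∪_; _∩_; _-_; ⋃; Nonempty; Empty)
open import Data.Fin.Subset.Properties
  using ( _∈?_; nonempty?; ⊆-antisym; ∉⊥; ∣⊥∣≡0; x∈p∪q⁺; x∈p∪q⁻; x∈p∩q⁺; x∈p∩q⁻
        ; x∈p∧x≢y⇒x∈p-y; x∈p⇒∣p-x∣<∣p∣)
open import Data.List using (List; []; _∷_; length)
open import Data.Vec.Base using ([]; _∷_)
open import Data.List.Relation.Unary.All as All using (All; []; _∷_)
open import Data.List.Relation.Unary.All.Properties using (all-filter; filter⁺; ¬Any⇒All¬)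
open import Data.List.Relation.Unary.Any as Any using (here; there)
open import Data.List.Relation.Unary.AllPairs using (AllPairs; []; _∷_)
open import Data.List.Relation.Unary.Unique.Propositional using (Unique)
import Data.List.Relation.Unary.Unique.Propositional.Properties as Unique
open import Data.List.Relation.Binary.Sublist.Propositional using ([]; _∷_; _∷ʳ_; ⊆-trans)
  renaming (_⊆_ to _⊑_)
open import Data.List.Relation.Binary.Sublist.Propositional.Properties using (All-resp-⊆; filter-⊆)
open import Data.List.Membership.Propositional using (find) renaming (_∈_ to _∈ₗ_)
open import Data.Product using (_×_; ∃; _,_; proj₁; proj₂)
open import Data.Sum using ([_,_]′; inj₁; inj₂)
open import Function using (_∘_)
open import Relation.Binary.Definitions using (Symmetric)
open import Relation.Unary using (Decidable)
open import Relation.Nullary using (¬_; yes; no; contradiction)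
open import Relation.Nullary.Decidable using (_×-dec_; ¬?; decidable-stable)
open import Relation.Binary.PropositionalEquality using (_≡_; _≢_; refl; sym; cong; subst)

∣p∪q∣≤∣p∣+∣q∣ : ∀ {n} (p q : Subset n) → ∣ p ∪ q ∣ ≤ ∣ p ∣ + ∣ q ∣
∣p∪q∣≤∣p∣+∣q∣ []            []            = z≤n
∣p∪q∣≤∣p∣+∣q∣ (outside ∷ p) (outside ∷ q) = ∣p∪q∣≤∣p∣+∣q∣ p q
∣p∪q∣≤∣p∣+∣q∣ (outside ∷ p) (inside  ∷ q) =
  ≤-trans (s≤s (∣p∪q∣≤∣p∣+∣q∣ p q)) (≤-reflexive (sym (+-suc ∣ p ∣ ∣ q ∣)))
∣p∪q∣≤∣p∣+∣q∣ (inside  ∷ p) (outside ∷ q) = s≤s (∣p∪q∣≤∣p∣+∣q∣ p q)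
∣p∪q∣≤∣p∣+∣q∣ (inside  ∷ p) (inside  ∷ q) =
  s≤s (≤-trans (∣p∪q∣≤∣p∣+∣q∣ p q) (+-monoʳ-≤ ∣ p ∣ (n≤1+n ∣ q ∣)))

x∈⋃⁺ : ∀ {n} {x : Fin n} {A M} → A ∈ₗ M → x ∈ A → x ∈ ⋃ M
x∈⋃⁺ (here refl) x∈A = x∈p∪q⁺ (inj₁ x∈A)
x∈⋃⁺ (there A∈M) x∈A = x∈p∪q⁺ (inj₂ (x∈⋃⁺ A∈M x∈A))

x∉⋃ : ∀ {n} {x : Fin n} {M} → All (x ∉_) M → x ∉ ⋃ M
x∉⋃ []                           = ∉⊥
x∉⋃ {M = A ∷ M} (x∉A ∷ x∉⋃M) x∈ = [ x∉A , x∉⋃ x∉⋃M ]′ (x∈p∪q⁻ A (⋃ M) x∈)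

∣⋃M∣≤k*length : ∀ {n k} {M : List (Subset n)} → All (λ A → ∣ A ∣ ≤ k) M → ∣ ⋃ M ∣ ≤ k * length M
∣⋃M∣≤k*length {n} []                = ≤-trans (≤-reflexive (∣⊥∣≡0 n)) z≤n
∣⋃M∣≤k*length {k = k} {A ∷ M} (∣A∣≤k ∷ ∣M∣≤k) = begin
  ∣ A ∪ ⋃ M ∣       ≤⟨ ∣p∪q∣≤∣p∣+∣q∣ A (⋃ M) ⟩
  ∣ A ∣ + ∣ ⋃ M ∣   ≤⟨ +-mono-≤ ∣A∣≤k (∣⋃M∣≤k*length ∣M∣≤k) ⟩
  k + k * length M  ≡⟨ *-suc k (length M) ⟨
  k * length (A ∷ M) ∎
  where open ≤-Reasoning

-- Pigeonhole: distinct elements of D have distinct witnesses in p, since R x determines its element.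
witnessed⇒length≤∣p∣ : ∀ {n} {A : Set} (R : Fin n → A → Set) → (∀ {x F G} → R x F → R x G → F ≡ G) →
                       (p : Subset n) {D : List A} → Unique D → All (λ F → ∃ λ x → x ∈ p × R x F) D →
                       length D ≤ ∣ p ∣
witnessed⇒length≤∣p∣ R R-functional p []            []                       = z≤n
witnessed⇒length≤∣p∣ R R-functional p (F∉D ∷ D-uniq) ((x , x∈p , RxF) ∷ ws) =
  ≤-trans (s≤s (witnessed⇒length≤∣p∣ R R-functional (p - x) D-uniq
                  (All.zipWith witness-in-p-x (F∉D , ws))))
          (x∈p⇒∣p-x∣<∣p∣ x∈p)
  where
  witness-in-p-x : ∀ {G} → _ ≢ G × (∃ λ y → y ∈ p × R y G) → ∃ λ y → y ∈ p - x × R y G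
  witness-in-p-x (F≢G , y , y∈p , RyG) =
    y , x∈p∧x≢y⇒x∈p-y y∈p (λ { refl → F≢G (R-functional RxF RyG) }) , RyG

Unique⇒length≤∣p∣ : ∀ {n} {p : Subset n} {xs} → Unique xs → All (_∈ p) xs → length xs ≤ ∣ p ∣
Unique⇒length≤∣p∣ {p = p} xs-uniq xs⊆p =
  witnessed⇒length≤∣p∣ _≡_ (λ { refl refl → refl }) p xs-uniq (All.map (λ {x} x∈p → x , x∈p , refl) xs⊆p)

∣p∣≤length⇒p⊆q : ∀ {n} {p q : Subset n} {xs} → Unique xs → All (_∈ p) xs → ∣ p ∣ ≤ length xs →
                 All (_∈ q) xs → p ⊆ q
∣p∣≤length⇒p⊆q {xs = xs} xs-uniq xs⊆p ∣p∣≤∣xs∣ xs⊆q {y} y∈p with Any.any? (y ≟_) xs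
... | yes y∈xs = All.lookup xs⊆q y∈xs
... | no  y∉xs =
  contradiction (Unique⇒length≤∣p∣ (¬Any⇒All¬ xs y∉xs ∷ xs-uniq) (y∈p ∷ xs⊆p)) (≤⇒≯ ∣p∣≤∣xs∣)

IsThirdPoint : ∀ {n} → Fin n → Fin n → Fin n → Subset n → Set
IsThirdPoint i j x F = ∣ F ∣ ≡ 3 × i ∈ F × j ∈ F × x ∈ F × x ≢ i × x ≢ j

IsThirdPoint-functional : ∀ {n} {i j x : Fin n} {F G} → i ≢ j →
                          IsThirdPoint i j x F → IsThirdPoint i j x G → F ≡ G
IsThirdPoint-functional {i = i} {j} {x} {F} {G} i≢j
  (∣F∣≡3 , iF , jF , xF , x≢i , x≢j) (∣G∣≡3 , iG , jG , xG , _) =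
  ⊆-antisym (∣p∣≤length⇒p⊆q ijx-uniq ijx⊆F (≤-reflexive ∣F∣≡3) ijx⊆G)
            (∣p∣≤length⇒p⊆q ijx-uniq ijx⊆G (≤-reflexive ∣G∣≡3) ijx⊆F)
  where
  ijx-uniq : Unique (i ∷ j ∷ x ∷ [])
  ijx-uniq = (i≢j ∷ (x≢i ∘ sym) ∷ []) ∷ ((x≢j ∘ sym) ∷ []) ∷ [] ∷ []
  ijx⊆F : All (_∈ F) (i ∷ j ∷ x ∷ [])
  ijx⊆F = iF ∷ jF ∷ xF ∷ []
  ijx⊆G : All (_∈ G) (i ∷ j ∷ x ∷ [])
  ijx⊆G = iG ∷ jG ∷ xG ∷ []

degree₂≤∣p∣ : ∀ {n} {H : Family n} {i j : Fin n} {p : Subset n} → Is3Uniform H → i ≢ j → i ∉ p → j ∉ p →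
              All (λ F → i ∈ F → j ∈ F → ¬ Empty (F ∩ p)) (members H) → degree₂ H i j ≤ ∣ p ∣
degree₂≤∣p∣ {H = H} {i} {j} {p} H₃ i≢j i∉p j∉p meets =
  witnessed⇒length≤∣p∣ (IsThirdPoint i j) (IsThirdPoint-functional i≢j) p (Unique.filter⁺ ij? (unique H))
    (All.map third-point (All.zip (filter⁺ ij? (All.zip (H₃ , meets)) , all-filter ij? (members H))))
  where
  ij? : Decidable (λ F → i ∈ F × j ∈ F)
  ij? = λ F → (i ∈? F) ×-dec (j ∈? F)
  third-point : ∀ {F} → (∣ F ∣ ≡ 3 × (i ∈ F → j ∈ F → ¬ Empty (F ∩ p))) × (i ∈ F × j ∈ F) →
                ∃ λ x → x ∈ p × IsThirdPoint i j x F
  third-point {F} ((∣F∣≡3 , F-meets) , iF , jF)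
    with x , x∈F∩p ← decidable-stable (nonempty? (F ∩ p)) (F-meets iF jF)
    with x∈F , x∈p ← x∈p∩q⁻ F p x∈F∩p
    = x , x∈p , ∣F∣≡3 , iF , jF , x∈F , (λ { refl → i∉p x∈p }) , (λ { refl → j∉p x∈p })

module _ {A : Set} {R : A → A → Set} (R-sym : Symmetric R) where

  -- The last component says that M′ is made of F and the members of M; the recursion needs it.
  AllPairs-⊑-insert : ∀ {F M L} → M ⊑ L → F ∈ₗ L → ¬ R F F → All (R F) M → AllPairs R M →
    ∃ λ M′ → M′ ⊑ L × AllPairs R M′ × length M′ ≡ suc (length M)
           × (∀ {P : A → Set} → P F → All P M → All P M′)
  AllPairs-⊑-insert (y ∷ʳ M⊑L) (here refl) _ RF*M R*M = _ , refl ∷ M⊑L , RF*M ∷ R*M , refl , _∷_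
  AllPairs-⊑-insert (y ∷ʳ M⊑L) (there F∈L) ¬RFF RF*M R*M
    with M′ , M′⊑L , R*M′ , ∣M′∣ , transfer ← AllPairs-⊑-insert M⊑L F∈L ¬RFF RF*M R*M
    = M′ , y ∷ʳ M′⊑L , R*M′ , ∣M′∣ , transfer
  AllPairs-⊑-insert (refl ∷ M⊑L) (here refl) ¬RFF (RFF ∷ _) _ = contradiction RFF ¬RFF
  AllPairs-⊑-insert (refl ∷ M⊑L) (there F∈L) ¬RFF (RFy ∷ RF*M) (Ry*M ∷ R*M)
    with M′ , M′⊑L , R*M′ , ∣M′∣ , transfer ← AllPairs-⊑-insert M⊑L F∈L ¬RFF RF*M R*M
    = _ ∷ M′ , refl ∷ M′⊑L , transfer (R-sym RFy) Ry*M ∷ R*M′ , cong suc ∣M′∣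
    , λ { PF (Py ∷ PM) → Py ∷ transfer PF PM }

Disjoint-sym : ∀ {n} → Symmetric (Disjoint {n})
Disjoint-sym p#q x x∈q x∈p = p#q x x∈p x∈q

extend⇒length<ν : ∀ {n} {H : Family n} {s M F} → ν≤ H s → IsMatching H M →
                  F ∈ₗ members H → Nonempty F → All (Disjoint F) M → length M < s
extend⇒length<ν ν≤s (M⊑H , M-disjoint) F∈H (x , x∈F) F#M
  with M′ , M′⊑H , M′-disjoint , ∣M′∣ , _ ←
       AllPairs-⊑-insert Disjoint-sym M⊑H F∈H (λ F#F → F#F x x∈F x∈F) F#M M-disjoint
  = subst (_≤ _) ∣M′∣ (ν≤s M′ (M′⊑H , M′-disjoint))

lemma3p4 : ∀ {n : ℕ} (H : Family n) (s : ℕ) (i j : Fin n) →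
    Is3Uniform H → ν≡ H s → InK (3 * s + 1) H i j →
    ν≤ (avoid H i j) (s ∸ 1)
lemma3p4 H s i j H₃ (_ , ν≤s) (i≢j , 3s+1≤deg) M (M⊑avoid , M-disjoint) = ∣M∣≤s∸1
  where
  avoids? : Decidable (λ F → i ∉ F × j ∉ F)
  avoids? = λ F → ¬? (i ∈? F) ×-dec ¬? (j ∈? F)
  M-avoids : All (λ A → i ∉ A × j ∉ A) M
  M-avoids = All-resp-⊆ M⊑avoid (all-filter avoids? (members H))
  M-matching : IsMatching H M
  M-matching = ⊆-trans M⊑avoid (filter-⊆ avoids? (members H)) , M-disjoint
  i∉⋃M : i ∉ ⋃ M
  i∉⋃M = x∉⋃ (All.map proj₁ M-avoids)
  j∉⋃M : j ∉ ⋃ M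
  j∉⋃M = x∉⋃ (All.map proj₂ M-avoids)

  ∣M∣≤s∸1 : length M ≤ s ∸ 1
  ∣M∣≤s∸1 with Any.any? (λ F → (i ∈? F) ×-dec (j ∈? F) ×-dec ¬? (nonempty? (F ∩ ⋃ M))) (members H)
  ... | yes misser =
    let F , F∈H , iF , _ , F∩⋃M-empty = find misser
        F#M = All.tabulate (λ A∈M x x∈F x∈A → F∩⋃M-empty (x , x∈p∩q⁺ (x∈F , x∈⋃⁺ A∈M x∈A)))
    in  ∸-monoˡ-≤ 1 (extend⇒length<ν {H = H} ν≤s M-matching F∈H (i , iF) F#M)
  ... | no none = contradiction (begin
    3 * s + 1      ≤⟨ 3s+1≤deg ⟩
    degree₂ H i j  ≤⟨ degree₂≤∣p∣ {H = H} H₃ i≢j i∉⋃M j∉⋃M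
                        (All.map (λ ¬miss iF jF empty → ¬miss (iF , jF , empty)) (¬Any⇒All¬ _ none)) ⟩
    ∣ ⋃ M ∣        ≤⟨ ∣⋃M∣≤k*length (All.map ≤-reflexive (All-resp-⊆ (proj₁ M-matching) H₃)) ⟩
    3 * length M   ≤⟨ *-monoʳ-≤ 3 (ν≤s M M-matching) ⟩
    3 * s          ∎) (m+1+n≰m (3 * s))
    where open ≤-Reasoning
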